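{- Let $\mathbf{h}$ be a weakly increasing sequence of positive integers with $\mathbf{h}(i)>i$ for all $i$, let $S$ be a nonempty $\mathbf{h}$-admissible set and $m=\mathbf{m}(S)$. Then for all integers $n\ge\mathbf{h}(m)$, $$\mathcal{I}_\mathbf{h}(S;n)=\sum_{k=\mathbf{h}(m)-m}^{\mathbf{h}(m)} b_k(S)\binom{n-k}{\mathbf{h}(m)-k}=\sum_{\ell=0}^{m} b_{\mathbf{h}(m)-\ell}(S)\binom{n-\mathbf{h}(m)+\ell}{\ell},$$ where $b_k(S)=\#B_k(S,\mathbf{h}(m))$ (so the right-hand side is the polynomial in $n$ agreeing with $\mathcal{I}_\mathbf{h}(S;n)$).
   Context: $\mathcal{P}_\mathbf{h}=\{(i,j): i<j\le \mathbf{h}(i)\}$. For $\pi\in S_n$ (one-line notation $\pi_1\cdots\pi_n$), $\mathrm{inv}_\mathbf{h}(\pi)=\{(i,j)\in\mathcal{P}_\mathbf{h}: j\le n,\ \pi_i>\pi_j\}$. $S\subseteq\mathcal{P}_\mathbf{h}$ is $\mathbf{h}$-admissible if $S=\mathrm{inv}_\mathbf{h}(\pi)$ for some permutation $\pi$ of some $S_n$. $I_\mathbf{h}(S,n)=\{\pi\in S_n:\mathrm{inv}_\mathbf{h}(\pi)=S\}$, $\mathcal{I}_\mathbf{h}(S;n)=\#I_\mathbf{h}(S,n)$. $\mathbf{m}(S)=\max\{i:(i,i+1)\in S\}$. $B_k(S,n)=\{\pi\in I_\mathbf{h}(S,n):\pi_{\mathbf{h}(m)}=k\}$. -}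

module Defs where

open import Data.Nat using (ℕ; zero; suc; _+_; _∸_; _≤_; _<_; _<ᵇ_; _⊔_)
import Data.Nat.Properties as ℕP
open import Data.Nat.Combinatorics using (_C_)
open import Data.Fin using (Fin; toℕ)
import Data.Fin.Properties as FinP
open import Data.Vec using (Vec; []; _∷_; toList)
open import Data.List using (List; []; _∷_; [_]; map; concatMap; filter; length; upTo; allFin)
open import Data.Nat.ListAction using (sum)
open import Data.List.Relation.Unary.All using (All; all?)
open import Data.List.Relation.Unary.Unique.Propositional using (Unique)
import Data.List.Relation.Unary.Unique.DecPropositional as UDec
open import Data.List.Membership.Propositional using (_∈_)
import Data.List.Membership.DecPropositional as MemDec
open import Data.List.Relation.Unary.All using (tabulate) renaming (lookup to lookupAll)
open import Data.Product using (Σ; _×_; _,_; proj₁; proj₂)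
open import Data.Product.Properties using (≡-dec)
open import Data.Bool using (Bool; true; false; if_then_else_; _∧_)
open import Relation.Binary.PropositionalEquality using (_≡_)
open import Relation.Nullary using (Dec; yes; no; ¬_)
open import Relation.Nullary.Decidable using (_×-dec_; does)

-- Positions and values are 1-based, as in the paper.
-- A pair (i , j) of positions.
Pair : Set
Pair = ℕ × ℕ

_≟P_ : (p q : Pair) → Dec (p ≡ q)
_≟P_ = ≡-dec ℕP._≟_ ℕP._≟_

allVecs : (len k : ℕ) → List (Vec (Fin k) len)
allVecs zero    k = [ [] ]
allVecs (suc l) k = concatMap (λ x → map (x ∷_) (allVecs l k)) (allFin k)

-- A permutation of S_n in one-line notation: a length-n vector with entries
-- in {0..n-1} (value v stands for v+1) and no repeated entry.
IsPerm : {n : ℕ} → Vec (Fin n) n → Set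
IsPerm π = Unique (toList π)

isPerm? : {n : ℕ} → (π : Vec (Fin n) n) → Dec (IsPerm π)
isPerm? {n} π = UDec.unique? FinP._≟_ (toList π)

SymGroup : (n : ℕ) → List (Vec (Fin n) n)
SymGroup n = filter isPerm? (allVecs n n)

-- 0-based lookup in a list of naturals with default 0.
nth : List ℕ → ℕ → ℕ
nth []       _       = 0
nth (x ∷ xs) zero    = x
nth (x ∷ xs) (suc i) = nth xs i

entry : {n : ℕ} → Vec (Fin n) n → ℕ → ℕ
entry π i = nth (map (λ v → suc (toℕ v)) (toList π)) (i ∸ 1)

range : ℕ → ℕ → List ℕ
range a b = map (a +_) (upTo (suc b ∸ a))

invh : (h : ℕ → ℕ) {n : ℕ} → Vec (Fin n) n → List Pair
invh h {n} π =
  concatMap (λ i → concatMap (λ j →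
      if (h i <ᵇ j) then [] else (if (entry π j <ᵇ entry π i) then [ (i , j) ] else []))
    (range (suc i) n))
  (range 1 n)

SameSet : List Pair → List Pair → Set
SameSet A B = ((p : Pair) → p ∈ A → p ∈ B) × ((p : Pair) → p ∈ B → p ∈ A)

sameSet? : (A B : List Pair) → Dec (SameSet A B)
_∈P?_ : (p : Pair) → (A : List Pair) → Dec (p ∈ A)
_∈P?_ = MemDec._∈?_ _≟P_

sameSet? A B with all? (_∈P? B) A | all? (_∈P? A) B
... | yes a | yes b = yes ((λ p p∈A → lookupAll a p∈A) , (λ p p∈B → lookupAll b p∈B))
... | no ¬a | _ = no (λ s → ¬a (tabulate (λ {p} p∈A → proj₁ s p p∈A)))
... | yes _ | no ¬b = no (λ s → ¬b (tabulate (λ {p} p∈B → proj₂ s p p∈B)))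

Admissible : (h : ℕ → ℕ) → List Pair → Set
Admissible h S = Σ ℕ (λ n → Σ (Vec (Fin n) n) (λ π → IsPerm π × SameSet (invh h π) S))

countI : (h : ℕ → ℕ) → List Pair → ℕ → ℕ
countI h S n = length (filter (λ π → sameSet? (invh h π) S) (SymGroup n))

-- m(S) = max { i : (i , i+1) ∈ S }   (0 if there is no such i)
mS : List Pair → ℕ
mS []             = 0
mS ((i , j) ∷ S) with j ℕP.≟ suc i
... | yes _ = i ⊔ mS S
... | no  _ = mS S

bk : (h : ℕ → ℕ) → List Pair → ℕ → ℕ
bk h S k = length (filter (λ π → sameSet? (invh h π) S ×-dec (entry π (h (mS S)) ℕP.≟ k))
                          (SymGroup (h (mS S))))

sumFromTo : ℕ → ℕ → (ℕ → ℕ) → ℕ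
sumFromTo a b f = sum (map f (range a b))

{-# OPTIONS --safe #-}
-- Let H = h(m). Every pair of S lies in [1, m] × [1, H], and a permutation whose h-inversion
-- set is S has no descent after position m. So for n ≥ H, deleting the last entry a + 1 of
-- some π ∈ I_h(S, n + 1) and standardising is a bijection onto the τ ∈ I_h(S, n) with τ_n ≤ a.
-- Hence A_n(v) = #{π ∈ I_h(S, n) : π_n < v} satisfies A_{n+1}(v) = Σ_{u<v} A_n(u), starting
-- from A_H(v) = Σ_{k<v} b_k, and the hockey-stick identity gives
-- 𝓘_h(S; n) = A_n(n + 1) = Σ_k b_k C(n − k, H − k). Finally b_k = 0 for k < H − m because
-- π_{m+1} < ⋯ < π_H, and substituting k = H − ℓ gives the second form.

module Submission where

open import Defs
open import Data.Bool using (true; false; T; if_then_else_)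
open import Data.Empty using (⊥-elim)
open import Data.Fin using (Fin; toℕ; fromℕ<; punchIn; punchOut)
import Data.Fin.Properties as Fin
open import Data.List
  using (List; []; _∷_; [_]; _++_; map; concatMap; filter; length; upTo; applyUpTo; allFin; cartesianProductWith)
open import Data.List.Membership.Propositional using (_∈_; find; lose)
open import Data.List.Membership.Propositional.Properties
  using ( ∈-map⁺; ∈-map⁻; ∈-upTo⁺; ∈-upTo⁻; ∈-filter⁺; ∈-filter⁻; ∈-allFin
        ; ∈-concatMap⁺; ∈-concatMap⁻; ∈-cartesianProductWith⁺)
open import Data.List.Membership.Propositional.Properties.WithK using (unique∧set⇒bag)
open import Data.List.Properties using (filter-none; filter-≐; length-map; map-∘; map-cong-local)
open import Data.List.Relation.Binary.BagAndSetEquality using (_∼[_]_; set; ∼bag⇒↭)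
open import Data.List.Relation.Binary.Permutation.Propositional.Properties using (↭-length)
open import Data.List.Relation.Unary.All as All using (All; []; _∷_)
import Data.List.Relation.Unary.All.Properties as All
open import Data.List.Relation.Unary.AllPairs using ([]; _∷_)
open import Data.List.Relation.Unary.Any using (here; there)
open import Data.List.Relation.Unary.Unique.Propositional using (Unique)
import Data.List.Relation.Unary.Unique.Propositional.Properties as Unique
open import Data.Nat
open import Data.Nat.Combinatorics using (_C_; nCk≡nC[n∸k]; nCk+nC[k+1]≡[n+1]C[k+1])
open import Data.Nat.ListAction using (sum)
open import Data.Nat.Properties
open import Algebra.Properties.CommutativeSemigroup +-commutativeSemigroup using (interchange)
open import Data.Product using (∃; _×_; _,_; proj₁; proj₂)
open import Data.Sum as Sum using (_⊎_; inj₁; inj₂; [_,_]′)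
open import Data.Vec using (Vec; []; _∷_; toList; _∷ʳ_; initLast) renaming (map to vmap)
import Data.Vec.Properties as Vec
open import Function using (_∘_; _⇔_; mk⇔; Equivalence)
open import Level using (Level; 0ℓ)
open import Relation.Binary.PropositionalEquality hiding ([_])
open import Relation.Nullary using (¬_; yes; no; contradiction)
open import Relation.Nullary.Decidable using (_×-dec_)
open import Relation.Unary using (Pred; Decidable)

private variable
  ℓ ℓ₁ ℓ₂ ℓ₃ : Level
  A B : Set ℓ

-- Finite sums

∑< : ℕ → (ℕ → ℕ) → ℕ
∑< zero    f = 0
∑< (suc n) f = f 0 + ∑< n (f ∘ suc)

∑<-cong : ∀ n {f g} → (∀ t → t < n → f t ≡ g t) → ∑< n f ≡ ∑< n g
∑<-cong zero    f≗g = refl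
∑<-cong (suc n) f≗g = cong₂ _+_ (f≗g 0 z<s) (∑<-cong n (λ t t<n → f≗g (suc t) (s<s t<n)))

∑<-vanish : ∀ n {f} → (∀ t → t < n → f t ≡ 0) → ∑< n f ≡ 0
∑<-vanish zero    f≗0 = refl
∑<-vanish (suc n) f≗0 = cong₂ _+_ (f≗0 0 z<s) (∑<-vanish n (λ t t<n → f≗0 (suc t) (s<s t<n)))

∑<-+ : ∀ a b f → ∑< (a + b) f ≡ ∑< a f + ∑< b (λ t → f (a + t))
∑<-+ zero    b f = refl
∑<-+ (suc a) b f = trans (cong (f 0 +_) (∑<-+ a b (f ∘ suc))) (sym (+-assoc (f 0) _ _))

∑<-suc : ∀ n f → ∑< (suc n) f ≡ ∑< n f + f n
∑<-suc zero    f = +-identityʳ (f 0)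
∑<-suc (suc n) f = trans (cong (f 0 +_) (∑<-suc n (f ∘ suc))) (sym (+-assoc (f 0) _ _))

∑<-distrib-+ : ∀ n f g → ∑< n (λ t → f t + g t) ≡ ∑< n f + ∑< n g
∑<-distrib-+ zero    f g = refl
∑<-distrib-+ (suc n) f g =
  trans (cong (f 0 + g 0 +_) (∑<-distrib-+ n (f ∘ suc) (g ∘ suc))) (interchange (f 0) (g 0) _ _)

∑<-distribˡ-* : ∀ n k f → k * ∑< n f ≡ ∑< n (λ t → k * f t)
∑<-distribˡ-* zero    k f = *-zeroʳ k
∑<-distribˡ-* (suc n) k f = trans (*-distribˡ-+ k (f 0) _) (cong (k * f 0 +_) (∑<-distribˡ-* n k (f ∘ suc)))

∑<-comm : ∀ a b (f : ℕ → ℕ → ℕ) →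
          ∑< a (λ i → ∑< b (f i)) ≡ ∑< b (λ j → ∑< a (λ i → f i j))
∑<-comm zero    b f = sym (∑<-vanish b (λ _ _ → refl))
∑<-comm (suc a) b f =
  trans (cong (∑< b (f 0) +_) (∑<-comm a b (f ∘ suc))) (sym (∑<-distrib-+ b (f 0) _))

∑<-reverse : ∀ n f → ∑< (suc n) f ≡ ∑< (suc n) (λ t → f (n ∸ t))
∑<-reverse zero    f = refl
∑<-reverse (suc n) f = begin
    f 0 + ∑< (suc n) (f ∘ suc)
  ≡⟨ cong (f 0 +_) (∑<-reverse n (f ∘ suc)) ⟩
    f 0 + ∑< (suc n) (λ t → f (suc (n ∸ t)))
  ≡⟨ +-comm (f 0) _ ⟩
    ∑< (suc n) (λ t → f (suc (n ∸ t))) + f 0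
  ≡⟨ cong₂ _+_ (∑<-cong (suc n) (λ t t≤n → cong f (sym (+-∸-assoc 1 (m<1+n⇒m≤n t≤n)))))
               (cong f (sym (n∸n≡0 (suc n)))) ⟩
    ∑< (suc n) (λ t → f (suc n ∸ t)) + f (suc n ∸ suc n)
  ≡⟨ sym (∑<-suc (suc n) (λ t → f (suc n ∸ t))) ⟩
    ∑< (suc (suc n)) (λ t → f (suc n ∸ t)) ∎
  where open ≡-Reasoning

sum-map-applyUpTo : ∀ N (g f : ℕ → ℕ) → sum (map g (applyUpTo f N)) ≡ ∑< N (g ∘ f)
sum-map-applyUpTo zero    g f = refl
sum-map-applyUpTo (suc N) g f = cong (g (f 0) +_) (sum-map-applyUpTo N g (f ∘ suc))

sumFromTo≡∑< : ∀ a b f → sumFromTo a b f ≡ ∑< (suc b ∸ a) (λ t → f (a + t))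
sumFromTo≡∑< a b f = trans (cong sum (sym (map-∘ (upTo (suc b ∸ a)))))
                           (sum-map-applyUpTo (suc b ∸ a) (f ∘ (a +_)) (λ t → t))

m<n∸o⇒o+m<n : ∀ o {m n} → m < n ∸ o → o + m < n
m<n∸o⇒o+m<n zero            m<n   = m<n
m<n∸o⇒o+m<n (suc o) {n = suc n} m<n∸o = s<s (m<n∸o⇒o+m<n o m<n∸o)

∈-range⁻ : ∀ {a b x} → x ∈ range a b → a ≤ x × x ≤ b
∈-range⁻ {a} x∈ with ∈-map⁻ (a +_) x∈
... | t , t∈ , refl = m≤m+n a t , m<1+n⇒m≤n (m<n∸o⇒o+m<n a (∈-upTo⁻ t∈))

∈-range⁺ : ∀ {a b x} → a ≤ x → x ≤ b → x ∈ range a b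
∈-range⁺ {a} {b} a≤x x≤b = subst (_∈ range a b) (m+[n∸m]≡n a≤x)
  (∈-map⁺ (a +_) (∈-upTo⁺ (∸-monoˡ-< (s≤s x≤b) a≤x)))

sumFromTo-cong : ∀ {a b f g} → (∀ k → a ≤ k → k ≤ b → f k ≡ g k) →
                 sumFromTo a b f ≡ sumFromTo a b g
sumFromTo-cong f≗g = cong sum (map-cong-local (All.tabulate λ k∈ →
  let a≤k , k≤b = ∈-range⁻ k∈ in f≗g _ a≤k k≤b))

∑<≡sumFromTo : ∀ {a} b f → a ≤ suc b → (∀ k → k < a → f k ≡ 0) →
               ∑< (suc b) f ≡ sumFromTo a b f
∑<≡sumFromTo {a} b f a≤1+b f≗0 = begin
    ∑< (suc b) f
  ≡⟨ cong (λ N → ∑< N f) (sym (m+[n∸m]≡n a≤1+b)) ⟩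
    ∑< (a + (suc b ∸ a)) f
  ≡⟨ ∑<-+ a (suc b ∸ a) f ⟩
    ∑< a f + ∑< (suc b ∸ a) (λ t → f (a + t))
  ≡⟨ cong (_+ ∑< (suc b ∸ a) (λ t → f (a + t))) (∑<-vanish a f≗0) ⟩
    ∑< (suc b ∸ a) (λ t → f (a + t))
  ≡⟨ sym (sumFromTo≡∑< a b f) ⟩
    sumFromTo a b f ∎
  where open ≡-Reasoning

sumFromTo-reverse : ∀ {a b} f → a ≤ b → sumFromTo a b f ≡ sumFromTo 0 (b ∸ a) (λ ℓ → f (b ∸ ℓ))
sumFromTo-reverse {a} {b} f a≤b = begin
    sumFromTo a b f
  ≡⟨ sumFromTo≡∑< a b f ⟩
    ∑< (suc b ∸ a) (λ t → f (a + t))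
  ≡⟨ cong (λ N → ∑< N (λ t → f (a + t))) (+-∸-assoc 1 a≤b) ⟩
    ∑< (suc (b ∸ a)) (λ t → f (a + t))
  ≡⟨ ∑<-reverse (b ∸ a) (λ t → f (a + t)) ⟩
    ∑< (suc (b ∸ a)) (λ t → f (a + (b ∸ a ∸ t)))
  ≡⟨ ∑<-cong (suc (b ∸ a)) (λ t t<1+b∸a → cong f (a+[b∸a∸t]≡b∸t (m<1+n⇒m≤n t<1+b∸a))) ⟩
    ∑< (suc (b ∸ a)) (λ t → f (b ∸ t))
  ≡⟨ sym (sumFromTo≡∑< 0 (b ∸ a) (λ ℓ → f (b ∸ ℓ))) ⟩
    sumFromTo 0 (b ∸ a) (λ ℓ → f (b ∸ ℓ)) ∎
  where
  open ≡-Reasoning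
  a+[b∸a∸t]≡b∸t : ∀ {t} → t ≤ b ∸ a → a + (b ∸ a ∸ t) ≡ b ∸ t
  a+[b∸a∸t]≡b∸t {t} t≤b∸a = trans (sym (+-∸-assoc a t≤b∸a)) (cong (_∸ t) (m+[n∸m]≡n a≤b))

-- Binomial coefficients

-- (d − 1) choose r, but 0 at d = 0 rather than (0 ∸ 1) C 0 = 1.
predC : ℕ → ℕ → ℕ
predC zero    r = 0
predC (suc d) r = d C r

predC-pascal : ∀ d r → predC d (suc r) + predC d r ≡ predC (suc d) (suc r)
predC-pascal zero    r = refl
predC-pascal (suc d) r = trans (+-comm (d C suc r) (d C r)) (nCk+nC[k+1]≡[n+1]C[k+1] d r)

predC-∸-vanish : ∀ {v} k r → v ≤ k → predC (v ∸ k) r ≡ 0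
predC-∸-vanish k r v≤k = cong (λ d → predC d r) (m≤n⇒m∸n≡0 v≤k)

hockey-stick : ∀ k r v → ∑< v (λ u → predC (u ∸ k) r) ≡ predC (v ∸ k) (suc r)
hockey-stick k r zero = sym (predC-∸-vanish k (suc r) z≤n)
hockey-stick k r (suc v) with k ≤? v
... | no k≰v =
  trans (∑<-vanish (suc v) (λ u u≤v → predC-∸-vanish k r (≤-trans (m<1+n⇒m≤n u≤v) (≰⇒≥ k≰v))))
        (sym (predC-∸-vanish k (suc r) (≰⇒> k≰v)))
... | yes k≤v = begin
    ∑< (suc v) (λ u → predC (u ∸ k) r)
  ≡⟨ ∑<-suc v _ ⟩
    ∑< v (λ u → predC (u ∸ k) r) + predC (v ∸ k) r
  ≡⟨ cong (_+ predC (v ∸ k) r) (hockey-stick k r v) ⟩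
    predC (v ∸ k) (suc r) + predC (v ∸ k) r
  ≡⟨ predC-pascal (v ∸ k) r ⟩
    predC (suc (v ∸ k)) (suc r)
  ≡⟨ cong (λ d → predC d (suc r)) (sym (+-∸-assoc 1 k≤v)) ⟩
    predC (suc v ∸ k) (suc r) ∎
  where open ≡-Reasoning

∑<-predC-0 : ∀ {v} N f → v ≤ N → ∑< N (λ k → f k * predC (v ∸ k) 0) ≡ ∑< v f
∑<-predC-0 {v} N f v≤N = begin
    ∑< N g
  ≡⟨ cong (λ M → ∑< M g) (sym (m+[n∸m]≡n v≤N)) ⟩
    ∑< (v + (N ∸ v)) g
  ≡⟨ ∑<-+ v (N ∸ v) g ⟩
    ∑< v g + ∑< (N ∸ v) (λ t → g (v + t))
  ≡⟨ cong₂ _+_ (∑<-cong v (λ k k<v → trans (cong (λ d → f k * predC d 0) (+-∸-assoc 1 k<v))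
                                            (*-identityʳ (f k))))
               (∑<-vanish (N ∸ v) (λ t _ → trans (cong (f (v + t) *_) (predC-∸-vanish (v + t) 0 (m≤m+n v t)))
                                                 (*-zeroʳ (f (v + t))))) ⟩
    ∑< v f + 0
  ≡⟨ +-identityʳ _ ⟩
    ∑< v f ∎
  where
  open ≡-Reasoning
  g : ℕ → ℕ
  g k = f k * predC (v ∸ k) 0

predC-as-C : ∀ {k H} r → k ≤ H → predC (suc (r + H) ∸ k) r ≡ (r + H ∸ k) C (H ∸ k)
predC-as-C {k} {H} r k≤H = begin
    predC (suc (r + H) ∸ k) r
  ≡⟨ cong (λ d → predC d r) (+-∸-assoc 1 (≤-trans k≤H (m≤n+m H r))) ⟩
    (r + H ∸ k) C r
  ≡⟨ cong (_C r) r+H∸k≡r+[H∸k] ⟩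
    (r + (H ∸ k)) C r
  ≡⟨ nCk≡nC[n∸k] (m≤m+n r (H ∸ k)) ⟩
    (r + (H ∸ k)) C (r + (H ∸ k) ∸ r)
  ≡⟨ cong₂ _C_ (sym r+H∸k≡r+[H∸k]) (m+n∸m≡n r (H ∸ k)) ⟩
    (r + H ∸ k) C (H ∸ k) ∎
  where
  open ≡-Reasoning
  r+H∸k≡r+[H∸k] : r + H ∸ k ≡ r + (H ∸ k)
  r+H∸k≡r+[H∸k] = +-∸-assoc r k≤H

C-reflect : ∀ {ℓ H n} → ℓ ≤ H → H ≤ n →
            (n ∸ (H ∸ ℓ)) C (H ∸ (H ∸ ℓ)) ≡ (n ∸ H + ℓ) C ℓ
C-reflect {ℓ} {H} {n} ℓ≤H H≤n = cong₂ _C_ n∸[H∸ℓ]≡n∸H+ℓ (m∸[m∸n]≡n ℓ≤H)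
  where
  n∸[H∸ℓ]≡n∸H+ℓ : n ∸ (H ∸ ℓ) ≡ n ∸ H + ℓ
  n∸[H∸ℓ]≡n∸H+ℓ = begin
      n ∸ (H ∸ ℓ)
    ≡⟨ cong (_∸ (H ∸ ℓ)) (sym (m∸n+n≡m H≤n)) ⟩
      n ∸ H + H ∸ (H ∸ ℓ)
    ≡⟨ +-∸-assoc (n ∸ H) (m∸n≤m H ℓ) ⟩
      n ∸ H + (H ∸ (H ∸ ℓ))
    ≡⟨ cong (n ∸ H +_) (m∸[m∸n]≡n ℓ≤H) ⟩
      n ∸ H + ℓ ∎
    where open ≡-Reasoning

module _ {P : Pred A ℓ₁} {Q : Pred A ℓ₂} {R : Pred A ℓ₃}
         (P? : Decidable P) (Q? : Decidable Q) (R? : Decidable R)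
         (split : ∀ {x} → P x → Q x ⊎ R x) (join : ∀ {x} → Q x ⊎ R x → P x)
         (disjoint : ∀ {x} → Q x → ¬ R x)
         where

  length-filter-⊎ : ∀ xs → length (filter P? xs) ≡ length (filter Q? xs) + length (filter R? xs)
  length-filter-⊎ []       = refl
  length-filter-⊎ (x ∷ xs) with P? x | Q? x | R? x | length-filter-⊎ xs
  ... | yes _  | yes qx | yes rx | _  = contradiction rx (disjoint qx)
  ... | yes _  | yes _  | no _   | ih = cong suc ih
  ... | yes _  | no _   | yes _  | ih = trans (cong suc ih) (sym (+-suc _ _))
  ... | yes px | no ¬qx | no ¬rx | _  = ⊥-elim ([ ¬qx , ¬rx ]′ (split px))
  ... | no ¬px | yes qx | _      | _  = contradiction (join (inj₁ qx)) ¬px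
  ... | no ¬px | no _   | yes rx | _  = contradiction (join (inj₂ rx)) ¬px
  ... | no _   | no _   | no _   | ih = ih

module _ {P : Pred A ℓ₁} (P? : Decidable P) (key : A → ℕ) where

  length-filter-key< : ∀ v xs →
    length (filter (λ x → P? x ×-dec (key x <? v)) xs)
      ≡ ∑< v (λ u → length (filter (λ x → P? x ×-dec (key x ≟ u)) xs))
  length-filter-key< zero    xs = cong length (filter-none _ (All.universal (λ _ → n≮0 ∘ proj₂) xs))
  length-filter-key< (suc v) xs = begin
      length (filter (λ x → P? x ×-dec (key x <? suc v)) xs)
    ≡⟨ length-filter-⊎ _ _ _ split join disjoint xs ⟩
      length (filter (λ x → P? x ×-dec (key x <? v)) xs) + #at v
    ≡⟨ cong (_+ #at v) (length-filter-key< v xs) ⟩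
      ∑< v #at + #at v
    ≡⟨ sym (∑<-suc v #at) ⟩
      ∑< (suc v) #at ∎
    where
    open ≡-Reasoning
    #at : ℕ → ℕ
    #at u = length (filter (λ x → P? x ×-dec (key x ≟ u)) xs)
    split : ∀ {x} → P x × key x < suc v → P x × key x < v ⊎ P x × key x ≡ v
    split (px , k<1+v) = Sum.map (px ,_) (px ,_) (m<1+n⇒m<n∨m≡n k<1+v)
    join : ∀ {x} → P x × key x < v ⊎ P x × key x ≡ v → P x × key x < suc v
    join (inj₁ (px , k<v))  = px , m<n⇒m<1+n k<v
    join (inj₂ (px , refl)) = px , n<1+n v
    disjoint : ∀ {x} → P x × key x < v → ¬ (P x × key x ≡ v)
    disjoint (_ , k<v) (_ , k≡v) = <-irrefl k≡v k<v

unique∧set⇒length≡ : ∀ {xs ys : List A} → Unique xs → Unique ys → xs ∼[ set ] ys →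
                     length xs ≡ length ys
unique∧set⇒length≡ xs! ys! xs≈ys = ↭-length (∼bag⇒↭ (unique∧set⇒bag xs! ys! xs≈ys))

≢[]⇒∃∈ : ∀ {xs : List A} → xs ≢ [] → ∃ (_∈ xs)
≢[]⇒∃∈ {xs = []}    xs≢[] = contradiction refl xs≢[]
≢[]⇒∃∈ {xs = x ∷ _} _     = x , here refl

unique-∷ʳ⁻ : ∀ (xs : List A) {y} → Unique (xs ++ [ y ]) → Unique xs × All (y ≢_) xs
unique-∷ʳ⁻ []       _           = [] , []
unique-∷ʳ⁻ (x ∷ xs) (x∉ ∷ xs!) with All.++⁻ xs x∉ | unique-∷ʳ⁻ xs xs!
... | x∉xs , x≢y ∷ [] | xs!′ , y∉xs = x∉xs ∷ xs!′ , (x≢y ∘ sym) ∷ y∉xs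

vmap-injective : ∀ {f : A → B} → (∀ {x y} → f x ≡ f y → x ≡ y) →
                 ∀ {n} {xs ys : Vec A n} → vmap f xs ≡ vmap f ys → xs ≡ ys
vmap-injective f-inj {xs = []}     {[]}     _  = refl
vmap-injective f-inj {xs = x ∷ xs} {y ∷ ys} eq with Vec.∷-injective eq
... | fx≡fy , eq′ = cong₂ _∷_ (f-inj fx≡fy) (vmap-injective f-inj eq′)

vmap-punchIn-surjective : ∀ {k l} (w : Fin (suc k)) (ys : Vec (Fin (suc k)) l) →
                          All (w ≢_) (toList ys) → ∃ λ zs → vmap (punchIn w) zs ≡ ys
vmap-punchIn-surjective w []       _            = [] , refl
vmap-punchIn-surjective w (y ∷ ys) (w≢y ∷ w∉ys) with vmap-punchIn-surjective w ys w∉ys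
... | zs , eq = punchOut w≢y ∷ zs , cong₂ _∷_ (Fin.punchIn-punchOut w≢y) eq

concatMap-map≡cartesianProductWith : ∀ {X : Set} (f : A → B → X) xs ys →
  concatMap (λ x → map (f x) ys) xs ≡ cartesianProductWith f xs ys
concatMap-map≡cartesianProductWith f []       ys = refl
concatMap-map≡cartesianProductWith f (x ∷ xs) ys =
  cong (map (f x) ys ++_) (concatMap-map≡cartesianProductWith f xs ys)

allVecs-suc : ∀ l k → allVecs (suc l) k ≡ cartesianProductWith _∷_ (allFin k) (allVecs l k)
allVecs-suc l k = concatMap-map≡cartesianProductWith _∷_ (allFin k) (allVecs l k)

∈-allVecs : ∀ {l k} (v : Vec (Fin k) l) → v ∈ allVecs l k
∈-allVecs []      = here refl
∈-allVecs {suc l} {k} (x ∷ v) =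
  subst (x ∷ v ∈_) (sym (allVecs-suc l k)) (∈-cartesianProductWith⁺ _∷_ (∈-allFin x) (∈-allVecs v))

allVecs-unique : ∀ l k → Unique (allVecs l k)
allVecs-unique zero    k = [] ∷ []
allVecs-unique (suc l) k = subst Unique (sym (allVecs-suc l k))
  (Unique.cartesianProductWith⁺ _∷_ Vec.∷-injective (Unique.allFin⁺ k) (allVecs-unique l k))

SymGroup-unique : ∀ n → Unique (SymGroup n)
SymGroup-unique n = Unique.filter⁺ isPerm? (allVecs-unique n n)

∈-SymGroup⁺ : ∀ {n} {π : Vec (Fin n) n} → IsPerm π → π ∈ SymGroup n
∈-SymGroup⁺ {π = π} = ∈-filter⁺ isPerm? (∈-allVecs π)

∈-SymGroup⁻ : ∀ {n} {π : Vec (Fin n) n} → π ∈ SymGroup n → IsPerm π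
∈-SymGroup⁻ {n} π∈ = proj₂ (∈-filter⁻ isPerm? {xs = allVecs n n} π∈)

-- entry for vectors that need not be square; entry π i unfolds to entry′ π i.
entry′ : ∀ {k l} → Vec (Fin k) l → ℕ → ℕ
entry′ π i = nth (map (λ v → suc (toℕ v)) (toList π)) (i ∸ 1)

entry′-∈ : ∀ {k l} (π : Vec (Fin k) l) {i} → i < l →
           ∃ λ x → x ∈ toList π × entry′ π (suc i) ≡ suc (toℕ x)
entry′-∈ (x ∷ π) {zero}  _         = x , here refl , refl
entry′-∈ (x ∷ π) {suc i} (s<s i<l) with entry′-∈ π i<l
... | y , y∈π , eq = y , there y∈π , eq

1≤entry′ : ∀ {k l} (π : Vec (Fin k) l) {i} → i < l → 1 ≤ entry′ π (suc i)
1≤entry′ π i<l with entry′-∈ π i<l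
... | _ , _ , eq = subst (1 ≤_) (sym eq) (s≤s z≤n)

entry′≤ : ∀ {k l} (π : Vec (Fin k) l) i → entry′ π i ≤ k
entry′≤ π i = nth-map≤ (toList π) (i ∸ 1)
  where
  nth-map≤ : ∀ {k} (xs : List (Fin k)) j → nth (map (λ v → suc (toℕ v)) xs) j ≤ k
  nth-map≤ []       j       = z≤n
  nth-map≤ (x ∷ xs) zero    = Fin.toℕ<n x
  nth-map≤ (x ∷ xs) (suc j) = nth-map≤ xs j

entry′-∷ʳ : ∀ {k l} (π : Vec (Fin k) l) y {i} → i < l →
            entry′ (π ∷ʳ y) (suc i) ≡ entry′ π (suc i)
entry′-∷ʳ (x ∷ π) y {zero}  _         = refl
entry′-∷ʳ (x ∷ π) y {suc i} (s<s i<l) = entry′-∷ʳ π y i<l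

entry′-∷ʳ-last : ∀ {k l} (π : Vec (Fin k) l) y → entry′ (π ∷ʳ y) (suc l) ≡ suc (toℕ y)
entry′-∷ʳ-last []      y = refl
entry′-∷ʳ-last (x ∷ π) y = entry′-∷ʳ-last π y

entry′-injective : ∀ {k l} (π : Vec (Fin k) l) → Unique (toList π) → ∀ {i j} → i < l → j < l →
                   entry′ π (suc i) ≡ entry′ π (suc j) → i ≡ j
entry′-injective (x ∷ π) _         {zero}  {zero}  _         _         _  = refl
entry′-injective (x ∷ π) (x∉π ∷ _) {zero}  {suc j} _         (s<s j<l) eq with entry′-∈ π j<l
... | y , y∈π , eq′ =
  contradiction (Fin.toℕ-injective (suc-injective (trans eq eq′))) (All.lookup x∉π y∈π)
entry′-injective (x ∷ π) (x∉π ∷ _) {suc i} {zero}  (s<s i<l) _         eq with entry′-∈ π i<l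
... | y , y∈π , eq′ =
  contradiction (Fin.toℕ-injective (suc-injective (trans (sym eq) eq′))) (All.lookup x∉π y∈π)
entry′-injective (x ∷ π) (_ ∷ π!)  {suc i} {suc j} (s<s i<l) (s<s j<l) eq =
  cong suc (entry′-injective π π! i<l j<l eq)

-- The effect of punchIn a on one-based values; 0, the junk value of entry, is fixed.
shift : ℕ → ℕ → ℕ
shift a       zero    = zero
shift zero    (suc x) = suc (suc x)
shift (suc a) (suc x) = suc (shift a x)

punchIn-shift : ∀ {n} (w : Fin (suc n)) (x : Fin n) →
                suc (toℕ (punchIn w x)) ≡ shift (toℕ w) (suc (toℕ x))
punchIn-shift Fin.zero    x           = refl
punchIn-shift (Fin.suc w) Fin.zero    = refl
punchIn-shift (Fin.suc w) (Fin.suc x) = cong suc (punchIn-shift w x)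

shift-≤ : ∀ {a x} → x ≤ a → shift a x ≡ x
shift-≤ {a}     {zero}  _         = refl
shift-≤ {suc a} {suc x} (s≤s x≤a) = cong suc (shift-≤ x≤a)

shift-> : ∀ {a x} → a < x → shift a x ≡ suc x
shift-> {zero}  {suc x} _         = refl
shift-> {suc a} {suc x} (s<s a<x) = cong suc (shift-> a<x)

shift-mono-< : ∀ a {x y} → x < y → shift a x < shift a y
shift-mono-< zero    {zero}  {suc y} _         = z<s
shift-mono-< (suc a) {zero}  {suc y} _         = z<s
shift-mono-< zero    {suc x} {suc y} (s<s x<y) = s<s (s<s x<y)
shift-mono-< (suc a) {suc x} {suc y} (s<s x<y) = s<s (shift-mono-< a x<y)

shift-cancel-< : ∀ a {x y} → shift a x < shift a y → x < y
shift-cancel-< a       {zero}  {suc y} _               = z<s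
shift-cancel-< zero    {suc x} {suc y} (s<s (s<s x<y)) = s<s x<y
shift-cancel-< (suc a) {suc x} {suc y} (s<s lt)        = s<s (shift-cancel-< a lt)

entry′-punchIn : ∀ {n l} (w : Fin (suc n)) (π : Vec (Fin n) l) i →
                 entry′ (vmap (punchIn w) π) i ≡ shift (toℕ w) (entry′ π i)
entry′-punchIn w π i = go π (i ∸ 1)
  where
  go : ∀ {l} (π : Vec (Fin _) l) j →
       nth (map (λ v → suc (toℕ v)) (toList (vmap (punchIn w) π))) j
         ≡ shift (toℕ w) (nth (map (λ v → suc (toℕ v)) (toList π)) j)
  go []      j       = refl
  go (x ∷ π) zero    = punchIn-shift w x
  go (x ∷ π) (suc j) = go π j

-- h-inversions

∈-guarded⁻ : ∀ c d {p q : Pair} → q ∈ (if c then [] else (if d then [ p ] else [])) →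
             c ≡ false × d ≡ true × q ≡ p
∈-guarded⁻ false true (here q≡p) = refl , refl , q≡p

module _ (h : ℕ → ℕ) where

  HInv : ∀ {n} → Vec (Fin n) n → ℕ → ℕ → Set
  HInv {n} π i j = 1 ≤ i × i < j × j ≤ n × j ≤ h i × entry π j < entry π i

  ∈-invh⁻ : ∀ {n} (π : Vec (Fin n) n) {i j} → (i , j) ∈ invh h π → HInv π i j
  ∈-invh⁻ {n} π ij∈ with find (∈-concatMap⁻ _ {xs = range 1 n} ij∈)
  ... | i′ , i′∈ , ij∈′ with find (∈-concatMap⁻ _ {xs = range (suc i′) n} ij∈′)
  ... | j′ , j′∈ , ij∈″ with ∈-guarded⁻ (h i′ <ᵇ j′) (entry π j′ <ᵇ entry π i′) ij∈″
  ... | j≤hi , πj<πi , refl with ∈-range⁻ i′∈ | ∈-range⁻ j′∈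
  ... | 1≤i , _ | i<j , j≤n =
    1≤i , i<j , j≤n ,
    ≮⇒≥ (λ hi<j → subst T j≤hi (<⇒<ᵇ hi<j)) , <ᵇ⇒< _ _ (subst T (sym πj<πi) _)

  ∈-invh⁺ : ∀ {n} (π : Vec (Fin n) n) {i j} → HInv π i j → (i , j) ∈ invh h π
  ∈-invh⁺ {n} π {i} {j} (1≤i , i<j , j≤n , j≤hi , πj<πi) =
    ∈-concatMap⁺′ (∈-range⁺ 1≤i (≤-trans (<⇒≤ i<j) j≤n))
                  (∈-concatMap⁺′ (∈-range⁺ i<j j≤n) guarded)
    where
    ∈-concatMap⁺′ : ∀ {f : ℕ → List Pair} {xs x y} → x ∈ xs → y ∈ f x → y ∈ concatMap f xs
    ∈-concatMap⁺′ {f} x∈ y∈ = ∈-concatMap⁺ f (lose x∈ y∈)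
    guarded : (i , j) ∈ (if h i <ᵇ j then [] else (if entry π j <ᵇ entry π i then [ (i , j) ] else []))
    guarded with h i <ᵇ j in hi<ᵇj | entry π j <ᵇ entry π i in πj<ᵇπi
    ... | false | true  = here refl
    ... | true  | _     = contradiction (<ᵇ⇒< (h i) j (subst T (sym hi<ᵇj) _)) (≤⇒≯ j≤hi)
    ... | false | false = ⊥-elim (subst T πj<ᵇπi (<⇒<ᵇ πj<πi))

descent : ∀ (e : ℕ → ℕ) {i j} → i < j → e j < e i → ∃ λ t → i ≤ t × t < j × e (suc t) < e t
descent e {i} i<j ej<ei = go (≤⇒≤′ i<j) ej<ei
  where
  go : ∀ {j} → suc i ≤′ j → e j < e i → ∃ λ t → i ≤ t × t < j × e (suc t) < e t
  go ≤′-refl            ei+1<ei = i , ≤-refl , ≤-refl , ei+1<ei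
  go (≤′-step {j} i<′j) ej+1<ei with e (suc j) <? e j
  ... | yes ej+1<ej = j , <⇒≤ (≤′⇒≤ i<′j) , ≤-refl , ej+1<ej
  ... | no  ej+1≮ej with go i<′j (≤-<-trans (≮⇒≥ ej+1≮ej) ej+1<ei)
  ...   | t , i≤t , t<j , et+1<et = t , i≤t , m<n⇒m<1+n t<j , et+1<et

mS-≥ : ∀ S {t} → (t , suc t) ∈ S → t ≤ mS S
mS-≥ ((i , j) ∷ S) t∈ with j ≟ suc i
mS-≥ ((i , j) ∷ S) (here refl) | yes _ = m≤m⊔n _ (mS S)
mS-≥ ((i , j) ∷ S) (there t∈)  | yes _ = ≤-trans (mS-≥ S t∈) (m≤n⊔m i (mS S))
mS-≥ ((i , j) ∷ S) (here refl) | no j≢1+i = contradiction refl j≢1+i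
mS-≥ ((i , j) ∷ S) (there t∈)  | no _ = mS-≥ S t∈

module _ (h : ℕ → ℕ) (S : List Pair) where

  record Realises {n} (π : Vec (Fin n) n) : Set where
    constructor realises
    field
      S⊆HInv : ∀ {i j} → (i , j) ∈ S → HInv h π i j
      HInv⊆S : ∀ {i j} → HInv h π i j → (i , j) ∈ S

  sameSet⇒realises : ∀ {n} {π : Vec (Fin n) n} → SameSet (invh h π) S → Realises π
  sameSet⇒realises {π = π} (inv⊆S , S⊆inv) =
    realises (∈-invh⁻ h π ∘ S⊆inv _) (inv⊆S _ ∘ ∈-invh⁺ h π)

  realises⇒sameSet : ∀ {n} {π : Vec (Fin n) n} → Realises π → SameSet (invh h π) S
  realises⇒sameSet {π = π} (realises S⊆HInv HInv⊆S) =
    (λ _ ij∈ → HInv⊆S (∈-invh⁻ h π ij∈)) , (λ _ ij∈ → ∈-invh⁺ h π (S⊆HInv ij∈))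

module Polynomiality (h : ℕ → ℕ)
                     (h-mono : ∀ i j → 1 ≤ i → i ≤ j → h i ≤ h j) (h-gt : ∀ i → 1 ≤ i → i < h i)
                     (S : List Pair) (S≢[] : S ≢ []) (adm : Admissible h S) where

  open Realises

  m : ℕ
  m = mS S

  H : ℕ
  H = h m

  descent≤m : ∀ {n} {π : Vec (Fin n) n} → Realises h S π →
              ∀ {t} → 1 ≤ t → suc t ≤ n → entry π (suc t) < entry π t → t ≤ m
  descent≤m ρ {t} 1≤t t<n desc = mS-≥ S (HInv⊆S ρ (1≤t , n<1+n t , t<n , h-gt t 1≤t , desc))

  ∈S-bounds : ∀ {i j} → (i , j) ∈ S → 1 ≤ i × i ≤ m × j ≤ H
  ∈S-bounds {i} {j} ij∈S = let _ , π , _ , inv≈S = adm in bounds (sameSet⇒realises h S {π = π} inv≈S)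
    where
    bounds : ∀ {n} {π : Vec (Fin n) n} → Realises h S π → 1 ≤ i × i ≤ m × j ≤ H
    bounds {π = π} ρ with S⊆HInv ρ ij∈S
    ... | 1≤i , i<j , j≤n , j≤hi , πj<πi with descent (entry π) i<j πj<πi
    ... | t , i≤t , t<j , desc = 1≤i , i≤m , ≤-trans j≤hi (h-mono i m 1≤i i≤m)
      where
      i≤m : i ≤ m
      i≤m = ≤-trans i≤t (descent≤m ρ (≤-trans 1≤i i≤t) (≤-trans t<j j≤n) desc)

  1≤m : 1 ≤ m
  1≤m = let _ , ij∈S = ≢[]⇒∃∈ S≢[]
            1≤i , i≤m , _ = ∈S-bounds ij∈S
        in ≤-trans 1≤i i≤m

  m<H : m < H
  m<H = h-gt m 1≤m

  ascending-after-m : ∀ {n} {π : Vec (Fin n) n} → Realises h S π →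
                      ∀ {i} → m < i → suc i ≤ n → entry π i ≤ entry π (suc i)
  ascending-after-m ρ m<i i<n = ≮⇒≥ (λ desc → <⇒≱ m<i (descent≤m ρ (m<n⇒0<n m<i) i<n desc))

  monotone-after-m : ∀ {n} {π : Vec (Fin n) n} → Realises h S π →
                     ∀ {i j} → m < i → i ≤ j → j ≤ n → entry π i ≤ entry π j
  monotone-after-m {n} {π} ρ {i} m<i i≤j = go (≤⇒≤′ i≤j)
    where
    go : ∀ {j} → i ≤′ j → j ≤ n → entry π i ≤ entry π j
    go ≤′-refl            _   = ≤-refl
    go (≤′-step {j} i≤′j) j<n =
      ≤-trans (go i≤′j (<⇒≤ j<n)) (ascending-after-m ρ (<-≤-trans m<i (≤′⇒≤ i≤′j)) j<n)

  ∸m≤entry : ∀ {n} {π : Vec (Fin n) n} → IsPerm π → Realises h S π →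
             ∀ {j} → m < j → j ≤ n → j ∸ m ≤ entry π j
  ∸m≤entry {n} {π} π! ρ {j} m<j j≤n =
    subst (λ j → j ∸ m ≤ entry π j) 1+t≡j (go (≤⇒≤′ (m≤m+n m _)) (subst (_≤ n) (sym 1+t≡j) j≤n))
    where
    1+t≡j : suc (m + (j ∸ suc m)) ≡ j
    1+t≡j = m+[n∸m]≡n m<j
    go : ∀ {t} → m ≤′ t → suc t ≤ n → suc t ∸ m ≤ entry π (suc t)
    go ≤′-refl t<n = subst (_≤ entry π (suc m)) (sym (m+n∸n≡m 1 m)) (1≤entry′ π t<n)
    go (≤′-step {t} m≤′t) t+1<n = begin
        suc (suc t) ∸ m       ≡⟨ +-∸-assoc 1 (m≤n⇒m≤1+n m≤t) ⟩
        suc (suc t ∸ m)       ≤⟨ s≤s (go m≤′t (<⇒≤ t+1<n)) ⟩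
        suc (entry π (suc t)) ≤⟨ ≤∧≢⇒< (ascending-after-m ρ (s≤s m≤t) t+1<n) (1+n≢n ∘ sym ∘ distinct) ⟩
        entry π (suc (suc t)) ∎
      where
      open ≤-Reasoning
      m≤t : m ≤ t
      m≤t = ≤′⇒≤ m≤′t
      distinct : entry π (suc t) ≡ entry π (suc (suc t)) → t ≡ suc t
      distinct = entry′-injective π π! (<⇒≤ t+1<n) t+1<n

  module Extension {n} (H≤n : H ≤ n) (w : Fin (suc n)) where

    a : ℕ
    a = toℕ w

    extend : Vec (Fin n) n → Vec (Fin (suc n)) (suc n)
    extend τ = vmap (punchIn w) τ ∷ʳ w

    entry-extend : ∀ τ {i} → 1 ≤ i → i ≤ n → entry (extend τ) i ≡ shift a (entry τ i)
    entry-extend τ {suc i} _ i<n =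
      trans (entry′-∷ʳ (vmap (punchIn w) τ) w i<n) (entry′-punchIn w τ (suc i))

    entry-extend-last : ∀ τ → entry (extend τ) (suc n) ≡ suc a
    entry-extend-last τ = entry′-∷ʳ-last (vmap (punchIn w) τ) w

    extend-preserves-< : ∀ τ {i j} → 1 ≤ i → i < j → j ≤ n →
                         entry (extend τ) j < entry (extend τ) i ⇔ entry τ j < entry τ i
    extend-preserves-< τ {i} {j} 1≤i i<j j≤n =
      mk⇔ (shift-cancel-< a ∘ subst₂ _<_ eqʲ eqⁱ) (subst₂ _<_ (sym eqʲ) (sym eqⁱ) ∘ shift-mono-< a)
      where
      eqⁱ : entry (extend τ) i ≡ shift a (entry τ i)
      eqⁱ = entry-extend τ 1≤i (≤-trans (<⇒≤ i<j) j≤n)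
      eqʲ : entry (extend τ) j ≡ shift a (entry τ j)
      eqʲ = entry-extend τ (≤-trans 1≤i (<⇒≤ i<j)) j≤n

    HInv-extend⁻ : ∀ τ {i j} → j ≤ n → HInv h (extend τ) i j → HInv h τ i j
    HInv-extend⁻ τ j≤n (1≤i , i<j , _ , j≤hi , desc) =
      1≤i , i<j , j≤n , j≤hi , Equivalence.to (extend-preserves-< τ 1≤i i<j j≤n) desc

    HInv-extend⁺ : ∀ τ {i j} → HInv h τ i j → HInv h (extend τ) i j
    HInv-extend⁺ τ (1≤i , i<j , j≤n , j≤hi , desc) =
      1≤i , i<j , m≤n⇒m≤1+n j≤n , j≤hi , Equivalence.from (extend-preserves-< τ 1≤i i<j j≤n) desc

    1≤n : 1 ≤ n
    1≤n = ≤-trans 1≤m (≤-trans (<⇒≤ m<H) H≤n)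

    realises-extend⁻ : ∀ τ → Realises h S (extend τ) → Realises h S τ × entry τ n ≤ a
    realises-extend⁻ τ ρ = realises S⊆HInv′ (HInv⊆S ρ ∘ HInv-extend⁺ τ) , ≮⇒≥ last-descent
      where
      S⊆HInv′ : ∀ {i j} → (i , j) ∈ S → HInv h τ i j
      S⊆HInv′ ij∈S =
        let _ , _ , j≤H = ∈S-bounds ij∈S in HInv-extend⁻ τ (≤-trans j≤H H≤n) (S⊆HInv ρ ij∈S)
      last-descent : ¬ a < entry τ n
      last-descent a<τn = <⇒≱ (<-≤-trans m<H H≤n) (descent≤m ρ 1≤n ≤-refl (subst₂ _<_
        (sym (entry-extend-last τ)) (sym (trans (entry-extend τ 1≤n ≤-refl) (shift-> a<τn))) (s<s a<τn)))

    -- A new inversion (i , n + 1) needs h i > n ≥ H, so i > m, and then τ i ≤ τ n ≤ a < suc a.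
    no-new-HInv : ∀ τ → Realises h S τ → entry τ n ≤ a → ∀ {i} → ¬ HInv h (extend τ) i (suc n)
    no-new-HInv τ ρ τn≤a {i} (1≤i , i<1+n , _ , 1+n≤hi , desc) with m <? i
    ... | no  m≮i = <⇒≱ (s≤s H≤n) (≤-trans 1+n≤hi (h-mono i m 1≤i (≮⇒≥ m≮i)))
    ... | yes m<i = <-asym desc (begin-strict
        entry (extend τ) i       ≡⟨ entry-extend τ 1≤i i≤n ⟩
        shift a (entry τ i)      ≡⟨ shift-≤ τi≤a ⟩
        entry τ i                ≤⟨ τi≤a ⟩
        a                        <⟨ n<1+n a ⟩
        suc a                    ≡⟨ sym (entry-extend-last τ) ⟩
        entry (extend τ) (suc n) ∎)
      where
      open ≤-Reasoning
      i≤n : i ≤ n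
      i≤n = m<1+n⇒m≤n i<1+n
      τi≤a : entry τ i ≤ a
      τi≤a = ≤-trans (monotone-after-m ρ m<i i≤n ≤-refl) τn≤a

    realises-extend⁺ : ∀ τ → Realises h S τ → entry τ n ≤ a → Realises h S (extend τ)
    realises-extend⁺ τ ρ τn≤a = realises (HInv-extend⁺ τ ∘ S⊆HInv ρ) HInv⊆S′
      where
      HInv⊆S′ : ∀ {i j} → HInv h (extend τ) i j → (i , j) ∈ S
      HInv⊆S′ inv@(_ , _ , j≤1+n , _) with m≤n⇒m<n∨m≡n j≤1+n
      ... | inj₁ j<1+n = HInv⊆S ρ (HInv-extend⁻ τ (m<1+n⇒m≤n j<1+n) inv)
      ... | inj₂ refl  = contradiction inv (no-new-HInv τ ρ τn≤a)

    toList-extend : ∀ τ → toList (extend τ) ≡ map (punchIn w) (toList τ) ++ [ w ]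
    toList-extend τ =
      trans (Vec.toList-∷ʳ w (vmap (punchIn w) τ)) (cong (_++ [ w ]) (Vec.toList-map (punchIn w) τ))

    isPerm-extend : ∀ {τ} → IsPerm τ → IsPerm (extend τ)
    isPerm-extend {τ} τ! = subst Unique (sym (toList-extend τ))
      (Unique.++⁺ (Unique.map⁺ (Fin.punchIn-injective w _ _) τ!) ([] ∷ []) w∉)
      where
      w∉ : ∀ {x} → ¬ (x ∈ map (punchIn w) (toList τ) × x ∈ [ w ])
      w∉ (x∈ , here refl) with ∈-map⁻ (punchIn w) x∈
      ... | y , _ , eq = Fin.punchInᵢ≢i w y (sym eq)

    extend-injective : ∀ {τ τ′} → extend τ ≡ extend τ′ → τ ≡ τ′
    extend-injective eq = vmap-injective (Fin.punchIn-injective w _ _) (Vec.∷ʳ-injectiveˡ _ _ eq)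

    extend-surjective : ∀ π → IsPerm π → entry π (suc n) ≡ suc a →
                        ∃ λ τ → IsPerm τ × extend τ ≡ π
    extend-surjective π π! πlast≡1+a with initLast π
    ... | ys , y , refl
      with Fin.toℕ-injective (suc-injective (trans (sym (entry′-∷ʳ-last ys y)) πlast≡1+a))
    ... | refl with unique-∷ʳ⁻ (toList ys) (subst Unique (Vec.toList-∷ʳ w ys) π!)
    ... | ys! , w∉ys with vmap-punchIn-surjective w ys w∉ys
    ... | τ , refl = τ , Unique.map⁻ (subst Unique (Vec.toList-map (punchIn w) τ) ys!) , refl

  realising : ∀ n {Q : Pred (Vec (Fin n) n) 0ℓ} → Decidable Q → List (Vec (Fin n) n)
  realising n Q? = filter (λ π → sameSet? (invh h π) S ×-dec Q? π) (SymGroup n)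

  module _ {n} {Q : Pred (Vec (Fin n) n) 0ℓ} (Q? : Decidable Q) where

    ∈-realising⁺ : ∀ {π} → IsPerm π → Realises h S π → Q π → π ∈ realising n Q?
    ∈-realising⁺ π! ρ q = ∈-filter⁺ _ (∈-SymGroup⁺ π!) (realises⇒sameSet h S ρ , q)

    ∈-realising⁻ : ∀ {π} → π ∈ realising n Q? → IsPerm π × Realises h S π × Q π
    ∈-realising⁻ π∈ with ∈-filter⁻ _ {xs = SymGroup n} π∈
    ... | π∈Sₙ , inv≈S , q = ∈-SymGroup⁻ π∈Sₙ , sameSet⇒realises h S inv≈S , q

    realising-unique : Unique (realising n Q?)
    realising-unique = Unique.filter⁺ _ (SymGroup-unique n)

  #endingAt : ℕ → ℕ → ℕ
  #endingAt n v = length (realising n (λ π → entry π n ≟ v))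

  #endingBelow : ℕ → ℕ → ℕ
  #endingBelow n v = length (realising n (λ π → entry π n <? v))

  #endingBelow≡∑< : ∀ n v → #endingBelow n v ≡ ∑< v (#endingAt n)
  #endingBelow≡∑< n v =
    length-filter-key< (λ π → sameSet? (invh h π) S) (λ π → entry π n) v (SymGroup n)

  countI≡#endingBelow : ∀ n → countI h S n ≡ #endingBelow n (suc n)
  countI≡#endingBelow n = cong length (filter-≐
    (λ π → sameSet? (invh h π) S) (λ π → sameSet? (invh h π) S ×-dec (entry π n <? suc n))
    ((λ {π} inv≈S → inv≈S , s≤s (entry′≤ π n)) , proj₁) (SymGroup n))

  #endingAt-0 : ∀ n → #endingAt (suc n) 0 ≡ 0
  #endingAt-0 n = cong length (filter-none
    (λ π → sameSet? (invh h π) S ×-dec (entry π (suc n) ≟ 0)) {SymGroup (suc n)}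
    (All.universal (λ π (_ , πₙ≡0) → <⇒≢ (1≤entry′ π ≤-refl) (sym πₙ≡0)) (SymGroup (suc n))))

  #endingAt-suc : ∀ {n} → H ≤ n → (w : Fin (suc n)) →
                  #endingAt (suc n) (suc (toℕ w)) ≡ #endingBelow n (suc (toℕ w))
  #endingAt-suc {n} H≤n w = begin
      #endingAt (suc n) (suc a)
    ≡⟨ unique∧set⇒length≡ (realising-unique (λ π → entry π (suc n) ≟ suc a))
                          (Unique.map⁺ extend-injective (realising-unique (λ τ → entry τ n <? suc a)))
                          (mk⇔ to from) ⟩
      length (map extend (realising n (λ τ → entry τ n <? suc a)))
    ≡⟨ length-map extend (realising n (λ τ → entry τ n <? suc a)) ⟩
      #endingBelow n (suc a) ∎
    where
    open ≡-Reasoning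
    open Extension H≤n w
    -- let rather than with: abstracting over these goals makes Agda normalise SymGroup (suc n).
    to : ∀ {π} → π ∈ realising (suc n) (λ π → entry π (suc n) ≟ suc a) →
                 π ∈ map extend (realising n (λ τ → entry τ n <? suc a))
    to {π} π∈ =
      let π! , ρ , πlast≡1+a   = ∈-realising⁻ (λ π → entry π (suc n) ≟ suc a) π∈
          τ , τ! , extend-τ≡π = extend-surjective π π! πlast≡1+a
          ρ′ , τn≤a           = realises-extend⁻ τ (subst (Realises h S) (sym extend-τ≡π) ρ)
      in subst (_∈ map extend (realising n (λ τ → entry τ n <? suc a))) extend-τ≡π
               (∈-map⁺ extend (∈-realising⁺ (λ τ → entry τ n <? suc a) τ! ρ′ (s≤s τn≤a)))
    from : ∀ {π} → π ∈ map extend (realising n (λ τ → entry τ n <? suc a)) →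
                   π ∈ realising (suc n) (λ π → entry π (suc n) ≟ suc a)
    from π∈ =
      let τ , τ∈ , π≡extend-τ = ∈-map⁻ extend π∈
          τ! , ρ , τn<1+a     = ∈-realising⁻ (λ τ → entry τ n <? suc a) τ∈
      in subst (_∈ realising (suc n) (λ π → entry π (suc n) ≟ suc a)) (sym π≡extend-τ)
               (∈-realising⁺ (λ π → entry π (suc n) ≟ suc a) (isPerm-extend τ!)
                             (realises-extend⁺ τ ρ (m<1+n⇒m≤n τn<1+a)) (entry-extend-last τ))

  #endingAt≡#endingBelow : ∀ {n u} → H ≤ n → u ≤ suc n → #endingAt (suc n) u ≡ #endingBelow n u
  #endingAt≡#endingBelow {n} {zero}  _   _       = trans (#endingAt-0 n) (sym (#endingBelow≡∑< n 0))
  #endingAt≡#endingBelow {n} {suc u} H≤n u<1+n =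
    subst (λ a → #endingAt (suc n) (suc a) ≡ #endingBelow n (suc a)) (Fin.toℕ-fromℕ< u<1+n)
          (#endingAt-suc H≤n (fromℕ< u<1+n))

  #endingBelow-closed : ∀ r {v} → v ≤ suc (r + H) →
                        #endingBelow (r + H) v ≡ ∑< (suc H) (λ k → bk h S k * predC (v ∸ k) r)
  #endingBelow-closed zero {v} v≤1+H = trans (#endingBelow≡∑< H v) (sym (∑<-predC-0 (suc H) (bk h S) v≤1+H))
  #endingBelow-closed (suc r) {v} v≤2+n = begin
      #endingBelow (suc n) v
    ≡⟨ #endingBelow≡∑< (suc n) v ⟩
      ∑< v (#endingAt (suc n))
    ≡⟨ ∑<-cong v (λ u u<v → #endingAt≡#endingBelow (m≤n+m H r) (u≤1+n u<v)) ⟩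
      ∑< v (#endingBelow n)
    ≡⟨ ∑<-cong v (λ u u<v → #endingBelow-closed r (u≤1+n u<v)) ⟩
      ∑< v (λ u → ∑< (suc H) (λ k → bk h S k * predC (u ∸ k) r))
    ≡⟨ ∑<-comm v (suc H) (λ u k → bk h S k * predC (u ∸ k) r) ⟩
      ∑< (suc H) (λ k → ∑< v (λ u → bk h S k * predC (u ∸ k) r))
    ≡⟨ ∑<-cong (suc H) (λ k _ → trans (sym (∑<-distribˡ-* v (bk h S k) (λ u → predC (u ∸ k) r)))
                                       (cong (bk h S k *_) (hockey-stick k r v))) ⟩
      ∑< (suc H) (λ k → bk h S k * predC (v ∸ k) (suc r)) ∎
    where
    open ≡-Reasoning
    n : ℕ
    n = r + H
    u≤1+n : ∀ {u} → u < v → u ≤ suc n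
    u≤1+n u<v = m<1+n⇒m≤n (<-≤-trans u<v v≤2+n)

  countI≡∑< : ∀ {n} → H ≤ n → countI h S n ≡ ∑< (suc H) (λ k → bk h S k * ((n ∸ k) C (H ∸ k)))
  countI≡∑< {n} H≤n = subst (λ n → countI h S n ≡ ∑< (suc H) (λ k → bk h S k * ((n ∸ k) C (H ∸ k))))
                            (m∸n+n≡m H≤n) (closed (n ∸ H))
    where
    closed : ∀ r → countI h S (r + H) ≡ ∑< (suc H) (λ k → bk h S k * ((r + H ∸ k) C (H ∸ k)))
    closed r = trans (countI≡#endingBelow (r + H)) (trans (#endingBelow-closed r ≤-refl)
                 (∑<-cong (suc H) (λ k k<1+H → cong (bk h S k *_) (predC-as-C r (m<1+n⇒m≤n k<1+H)))))

  bk-vanish : ∀ {k} → k < H ∸ m → bk h S k ≡ 0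
  bk-vanish {k} k<H∸m = cong length (filter-none
    (λ π → sameSet? (invh h π) S ×-dec (entry π H ≟ k)) {SymGroup H}
    (All.tabulate λ {π} π∈ (inv≈S , πH≡k) → <⇒≱ k<H∸m (subst (H ∸ m ≤_) πH≡k
      (∸m≤entry (∈-SymGroup⁻ π∈) (sameSet⇒realises h S inv≈S) m<H ≤-refl))))

corollary3p2 : (h : ℕ → ℕ)
    → (∀ i j → 1 ≤ i → i ≤ j → h i ≤ h j)
    → (∀ i → 1 ≤ i → i < h i)
    → (S : List Pair) → S ≢ [] → Admissible h S
    → (n : ℕ) → h (mS S) ≤ n
    → (countI h S n ≡ sumFromTo (h (mS S) ∸ mS S) (h (mS S))
                        (λ k → bk h S k * ((n ∸ k) C (h (mS S) ∸ k))))
      × (countI h S n ≡ sumFromTo 0 (mS S)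
                        (λ ℓ → bk h S (h (mS S) ∸ ℓ) * ((n ∸ h (mS S) + ℓ) C ℓ)))
corollary3p2 h h-mono h-gt S S≢[] adm n H≤n = byTerm , trans byTerm reindexed
  where
  open Polynomiality h h-mono h-gt S S≢[] adm
  f : ℕ → ℕ
  f k = bk h S k * ((n ∸ k) C (H ∸ k))
  byTerm : countI h S n ≡ sumFromTo (H ∸ m) H f
  byTerm = trans (countI≡∑< H≤n)
                 (∑<≡sumFromTo H f (m≤n⇒m≤1+n (m∸n≤m H m))
                               (λ k k<H∸m → cong (_* ((n ∸ k) C (H ∸ k))) (bk-vanish k<H∸m)))
  reindexed : sumFromTo (H ∸ m) H f ≡ sumFromTo 0 m (λ ℓ → bk h S (H ∸ ℓ) * ((n ∸ H + ℓ) C ℓ))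
  reindexed = begin
      sumFromTo (H ∸ m) H f
    ≡⟨ sumFromTo-reverse f (m∸n≤m H m) ⟩
      sumFromTo 0 (H ∸ (H ∸ m)) (λ ℓ → f (H ∸ ℓ))
    ≡⟨ cong (λ b → sumFromTo 0 b (λ ℓ → f (H ∸ ℓ))) (m∸[m∸n]≡n (<⇒≤ m<H)) ⟩
      sumFromTo 0 m (λ ℓ → f (H ∸ ℓ))
    ≡⟨ sumFromTo-cong {0} {m} {λ ℓ → f (H ∸ ℓ)} (λ ℓ _ ℓ≤m →
         cong (bk h S (H ∸ ℓ) *_) (C-reflect (≤-trans ℓ≤m (<⇒≤ m<H)) H≤n)) ⟩
      sumFromTo 0 m (λ ℓ → bk h S (H ∸ ℓ) * ((n ∸ H + ℓ) C ℓ)) ∎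
    where open ≡-Reasoning
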